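{- Let $M$ be a binary $n \times m$ matrix with no column consisting only of zeros, and let $M_e$ be the extended matrix associated with $M$. Then $M$ admits a persistent perfect phylogeny (p-pp tree) if and only if there exists a completion of $M_e$ that admits a (directed) perfect phylogeny (pp tree).
   Context: Rows of a binary matrix are species, columns are characters; entry $1$ means the species has the character. A pp tree for a binary $n\times k$ matrix $N$ is a rooted tree $T$ in which each node $x$ is labeled by a vector $l_x\in\{0,1\}^k$, the root is labeled by the all-zero vector, for each column $j$ there is at most one edge $(u,v)$ with $l_u[j]\neq l_v[j]$ (necessarily $l_u[j]=0,l_v[j]=1$; the edge is labeled by character $j$), and each row of $N$ labels exactly one leaf of $T$ (whose label vector equals that row). A p-pp tree for a binary $n\times m$ matrix $M$ with characters $c_1,\dots,c_m$ is a rooted tree $T$ whose nodes $x$ are labeled by vectors $l_x\in\{0,1\}^m$, the root labeled by the all-zero vector, such that for each character $c_j$ there are at most two edges $(x,y)$ with $l_x[j]\ne l_y[j]$; if there are two, they lie on a common root-to-leaf path, and the one closer to the root changes $c_j$ from $0$ to $1$ (labeled $c_j$) while the other changes it from $1$ to $0$ (labeled $\bar c_j$); and each row of $M$ labels exactly one leaf of $T$ (whose label vector equals that row). The extended matrix $M_e$ of $M$ is the $n\times 2m$ matrix over $\{0,1,?\}$ obtained by replacing each column $c$ of $M$ by a pair of columns $(c,\bar c)$ (positive and negated character) where, for each row $s$: if $M[s,c]=1$ then $(M_e[s,c],M_e[s,\bar c])=(1,0)$, and if $M[s,c]=0$ then $(M_e[s,c],M_e[s,\bar c])=(?,?)$.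 A completion of $M_e$ is obtained by replacing, for every character $c$ and every row $s$, each pair $(?,?)$ in columns $(c,\bar c)$ by either $(0,0)$ or $(1,1)$; it is a binary $n\times 2m$ matrix. -}

module Defs where

open import Data.Bool using (Bool; true; false; _xor_)
open import Data.Nat using (ℕ; zero; suc; _*_; _≤_)
open import Data.Fin using (Fin; zero; suc; combine; remQuot)
open import Data.Vec using (Vec; lookup; replicate)
open import Data.List using (List; []; _∷_; _++_; map; length; filterᵇ)
open import Data.List.Membership.Propositional using (_∈_)
open import Data.Product using (Σ; ∃; _×_; _,_; proj₁; proj₂)
open import Data.Sum using (_⊎_)
open import Relation.Binary.PropositionalEquality using (_≡_; _≢_)

-- Binary matrices: rows (species) indexed by Fin n, columns (characters)
-- indexed by Fin k.

BinMatrix : ℕ → ℕ → Set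
BinMatrix n k = Fin n → Fin k → Bool

-- Rooted (ordered) trees whose nodes carry labels.  A node is addressed
-- by its path from the root (list of child indices).

data Tree (A : Set) : Set where
  node : A → List (Tree A) → Tree A

Path : Set
Path = List ℕ

rootLabel : ∀ {A : Set} → Tree A → A
rootLabel (node a _) = a

-- An edge (u , v) is recorded as (path to v , label of u , label of v).
Edge : Set → Set
Edge A = Path × A × A

edgePath : ∀ {A : Set} → Edge A → Path
edgePath = proj₁

parentLabel : ∀ {A : Set} → Edge A → A
parentLabel e = proj₁ (proj₂ e)

childLabel : ∀ {A : Set} → Edge A → A
childLabel e = proj₂ (proj₂ e)

prependE : ∀ {A : Set} → ℕ → Edge A → Edge A
prependE i e = (i ∷ edgePath e , parentLabel e , childLabel e)

prependL : ∀ {A : Set} → ℕ → Path × A → Path × A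
prependL i e = (i ∷ proj₁ e , proj₂ e)

mutual
  edges : ∀ {A : Set} → Tree A → List (Edge A)
  edges (node a ts) = edgesF a 0 ts

  edgesF : ∀ {A : Set} → A → ℕ → List (Tree A) → List (Edge A)
  edgesF a i [] = []
  edgesF a i (t ∷ ts) =
    (i ∷ [] , a , rootLabel t) ∷ (map (prependE i) (edges t) ++ edgesF a (suc i) ts)

mutual
  leaves : ∀ {A : Set} → Tree A → List (Path × A)
  leaves (node a []) = ([] , a) ∷ []
  leaves (node a (t ∷ ts)) = leavesF 0 (t ∷ ts)

  leavesF : ∀ {A : Set} → ℕ → List (Tree A) → List (Path × A)
  leavesF i [] = []
  leavesF i (t ∷ ts) = map (prependL i) (leaves t) ++ leavesF (suc i) ts

ProperAncestor : Path → Path → Set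
ProperAncestor p q = Σ Path λ r → r ≢ [] × q ≡ p ++ r

changes : ∀ {k} → Fin k → Edge (Vec Bool k) → Bool
changes j e = lookup (parentLabel e) j xor lookup (childLabel e) j

#changes : ∀ {k} → Tree (Vec Bool k) → Fin k → ℕ
#changes T j = length (filterᵇ (changes j) (edges T))

RowsLabelLeaves : ∀ {n k} → BinMatrix n k → Tree (Vec Bool k) → Set
RowsLabelLeaves {n} {k} N T =
  Σ (Fin n → Path × Vec Bool k) λ σ →
    (∀ s → σ s ∈ leaves T) ×
    (∀ s (j : Fin k) → lookup (proj₂ (σ s)) j ≡ N s j) ×
    (∀ s s′ → proj₁ (σ s) ≡ proj₁ (σ s′) → s ≡ s′)

IsPPTree : ∀ {n k} → BinMatrix n k → Tree (Vec Bool k) → Set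
IsPPTree {n} {k} N T =
  rootLabel T ≡ replicate k false ×
  (∀ (j : Fin k) → #changes T j ≤ 1) ×
  RowsLabelLeaves N T

HasPPTree : ∀ {n k} → BinMatrix n k → Set
HasPPTree {n} {k} N = Σ (Tree (Vec Bool k)) λ T → IsPPTree N T

TwoChangesOK : ∀ {k} → Fin k → Edge (Vec Bool k) → Edge (Vec Bool k) → Set
TwoChangesOK j e₁ e₂ =
  ( ProperAncestor (edgePath e₁) (edgePath e₂)
  × lookup (parentLabel e₁) j ≡ false × lookup (childLabel e₁) j ≡ true
  × lookup (parentLabel e₂) j ≡ true × lookup (childLabel e₂) j ≡ false )
  ⊎
  ( ProperAncestor (edgePath e₂) (edgePath e₁)
  × lookup (parentLabel e₂) j ≡ false × lookup (childLabel e₂) j ≡ true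
  × lookup (parentLabel e₁) j ≡ true × lookup (childLabel e₁) j ≡ false )

IsPPPTree : ∀ {n m} → BinMatrix n m → Tree (Vec Bool m) → Set
IsPPPTree {n} {m} M T =
  rootLabel T ≡ replicate m false ×
  (∀ (j : Fin m) → #changes T j ≤ 2) ×
  (∀ (j : Fin m) (e₁ e₂ : Edge (Vec Bool m)) →
     e₁ ∈ edges T → e₂ ∈ edges T →
     changes j e₁ ≡ true → changes j e₂ ≡ true →
     edgePath e₁ ≢ edgePath e₂ →
     TwoChangesOK j e₁ e₂) ×
  RowsLabelLeaves M T

HasPPPTree : ∀ {n m} → BinMatrix n m → Set
HasPPPTree {n} {m} M = Σ (Tree (Vec Bool m)) λ T → IsPPPTree M T

-- Extended matrix.  Column c of M becomes the pair of columns
-- (c , c̄) = (combine c 0 , combine c 1) of an n × (m * 2) matrix,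
-- i.e. columns 2c and 2c+1.

data Entry : Set where
  e0 e1 e? : Entry

posCol : ∀ {m} → Fin m → Fin (m * 2)
posCol c = combine c zero

negCol : ∀ {m} → Fin m → Fin (m * 2)
negCol c = combine c (suc zero)

extEntry : Bool → Fin 2 → Entry
extEntry true  zero       = e1
extEntry true  (suc zero) = e0
extEntry false _          = e?

extended : ∀ {n m} → BinMatrix n m → Fin n → Fin (m * 2) → Entry
extended {n} {m} M s col with remQuot {m} 2 col
... | c , b = extEntry (M s c) b

IsCompletion : ∀ {n m} → (Fin n → Fin (m * 2) → Entry) → BinMatrix n (m * 2) → Set
IsCompletion {n} {m} E N =
  (∀ s col → E s col ≡ e0 → N s col ≡ false) ×
  (∀ s col → E s col ≡ e1 → N s col ≡ true) ×
  (∀ s (c : Fin m) → E s (posCol c) ≡ e? → E s (negCol c) ≡ e? →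
     N s (posCol c) ≡ N s (negCol c))

NoZeroColumn : ∀ {n m} → BinMatrix n m → Set
NoZeroColumn {n} {m} M = ∀ (c : Fin m) → ∃ λ (s : Fin n) → M s c ≡ true

module Submission where

-- (⇒) Given a p-pp tree T for M, annotate every node by its state vector o
--     and the pointwise disjunction g of the states along its root path
--     ("c has been gained").  Relabelling each node by c ↦ g[c] and
--     c̄ ↦ g[c] ∧ ¬ o[c] ("c has been lost") gives a pp tree: column c changes
--     only where c is gained, and c̄ only where c is lost, because persistence
--     forbids a 0→1 edge of c below its 1→0 edge.  Its leaf rows complete M_e.
-- (⇐) Given a pp tree for a completion N of M_e, relabel each node by
--     c ↦ l[c] ∧ ¬ l[c̄].  The state of c changes only on the (unique) edges
--     of c and of c̄, both of which switch 0→1; the edge of c̄ lies below the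
--     one of c, which gives the p-pp ordering, and the leaf rows are M.

open import Defs
open import Data.Nat using (ℕ; _*_)
open import Data.Product using (Σ; _×_)
open import Function.Bundles using (_⇔_)

open import Data.Bool using (Bool; true; false; _xor_; _∧_; _∨_; not)
open import Data.Bool.Properties using (∧-zeroʳ; ∨-zeroʳ; ∧-identityʳ; ∧-inverseʳ; ∧-conicalˡ; xor-identityʳ; xor-annihilates-not)
open import Data.Nat using (zero; suc; _≤_; _+_; z≤n; s≤s)
open import Data.Nat.Properties using (≤-refl; ≤-trans; ≤-reflexive; n≤1+n; <⇒≤; <-irrefl; ≤⇒≯; +-mono-≤; +-monoʳ-≤; +-suc)
import Data.Nat.Properties as ℕ
open import Data.Fin using (Fin; combine; remQuot)
open import Data.Fin.Properties using (remQuot-combine; combine-remQuot)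
open import Data.Vec using (Vec; lookup; replicate; tabulate; zipWith)
open import Data.Vec.Properties using (lookup∘tabulate; lookup-zipWith; lookup-replicate)
open import Data.List using (List; []; _∷_; _++_; map; length; filterᵇ)
open import Data.List.Properties using (map-++; map-∘; ∷-injectiveʳ; ++-identityʳ-unique; ++-conicalˡ; ++-assoc; ≡-dec)
open import Data.List.Membership.Propositional using (_∈_)
open import Data.List.Membership.Propositional.Properties using (∈-map⁻; ∈-map⁺; ∈-++⁻; ∈-++⁺ˡ; ∈-++⁺ʳ)
open import Data.List.Relation.Unary.Any using (here; there)
open import Data.List.Relation.Unary.All as All using (All; []; _∷_)
import Data.List.Relation.Unary.All.Properties as All
open import Data.List.Relation.Unary.AllPairs as AllPairs using (AllPairs; []; _∷_)
import Data.List.Relation.Unary.AllPairs.Properties as AllPairs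
open import Data.Product using (_,_; proj₁; proj₂; ∃)
open import Data.Sum using (_⊎_; inj₁; inj₂)
open import Data.Empty using (⊥; ⊥-elim)
open import Function using (_∘_)
open import Function.Bundles using (mk⇔)
open import Relation.Nullary using (yes; no; contradiction)
open import Relation.Binary.PropositionalEquality

private
  variable
    A B : Set

mutual
  mapTree : (A → B) → Tree A → Tree B
  mapTree f (node a ts) = node (f a) (mapForest f ts)

  mapForest : (A → B) → List (Tree A) → List (Tree B)
  mapForest f []       = []
  mapForest f (t ∷ ts) = mapTree f t ∷ mapForest f ts

rootLabel-mapTree : (f : A → B) (t : Tree A) → rootLabel (mapTree f t) ≡ f (rootLabel t)
rootLabel-mapTree f (node a ts) = refl

mapEdge : (A → B) → Edge A → Edge B
mapEdge f (p , a , b) = (p , f a , f b)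

mapLeaf : (A → B) → Path × A → Path × B
mapLeaf f (p , a) = (p , f a)

mutual
  edges-mapTree : (f : A → B) (t : Tree A) → edges (mapTree f t) ≡ map (mapEdge f) (edges t)
  edges-mapTree f (node a ts) = edgesF-mapForest f a 0 ts

  edgesF-mapForest : (f : A → B) (a : A) (i : ℕ) (ts : List (Tree A)) →
    edgesF (f a) i (mapForest f ts) ≡ map (mapEdge f) (edgesF a i ts)
  edgesF-mapForest f a i []              = refl
  edgesF-mapForest f a i (t@(node b us) ∷ ts) = cong ((i ∷ [] , f a , f b) ∷_) (begin
      map (prependE i) (edges (mapTree f t)) ++ edgesF (f a) (suc i) (mapForest f ts)
        ≡⟨ cong₂ _++_ (cong (map (prependE i)) (edges-mapTree f t)) (edgesF-mapForest f a (suc i) ts) ⟩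
      map (prependE i) (map (mapEdge f) (edges t)) ++ map (mapEdge f) (edgesF a (suc i) ts)
        ≡⟨ cong (_++ _) (trans (sym (map-∘ (edges t))) (map-∘ (edges t))) ⟩
      map (mapEdge f) (map (prependE i) (edges t)) ++ map (mapEdge f) (edgesF a (suc i) ts)
        ≡⟨ sym (map-++ (mapEdge f) (map (prependE i) (edges t)) (edgesF a (suc i) ts)) ⟩
      map (mapEdge f) (map (prependE i) (edges t) ++ edgesF a (suc i) ts) ∎)
    where open ≡-Reasoning

mutual
  leaves-mapTree : (f : A → B) (t : Tree A) → leaves (mapTree f t) ≡ map (mapLeaf f) (leaves t)
  leaves-mapTree f (node a [])       = refl
  leaves-mapTree f (node a (t ∷ ts)) = leavesF-mapForest f 0 (t ∷ ts)

  leavesF-mapForest : (f : A → B) (i : ℕ) (ts : List (Tree A)) →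
    leavesF i (mapForest f ts) ≡ map (mapLeaf f) (leavesF i ts)
  leavesF-mapForest f i []       = refl
  leavesF-mapForest f i (t ∷ ts) = begin
      map (prependL i) (leaves (mapTree f t)) ++ leavesF (suc i) (mapForest f ts)
        ≡⟨ cong₂ _++_ (cong (map (prependL i)) (leaves-mapTree f t)) (leavesF-mapForest f (suc i) ts) ⟩
      map (prependL i) (map (mapLeaf f) (leaves t)) ++ map (mapLeaf f) (leavesF (suc i) ts)
        ≡⟨ cong (_++ _) (trans (sym (map-∘ (leaves t))) (map-∘ (leaves t))) ⟩
      map (mapLeaf f) (map (prependL i) (leaves t)) ++ map (mapLeaf f) (leavesF (suc i) ts)
        ≡⟨ sym (map-++ (mapLeaf f) (map (prependL i) (leaves t)) (leavesF (suc i) ts)) ⟩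
      map (mapLeaf f) (map (prependL i) (leaves t) ++ leavesF (suc i) ts) ∎
    where open ≡-Reasoning

leaf-mapTree⁻ : (f : A → B) (t : Tree A) {l : Path × B} → l ∈ leaves (mapTree f t) →
  ∃ λ l′ → l′ ∈ leaves t × l ≡ mapLeaf f l′
leaf-mapTree⁻ f t l∈ = ∈-map⁻ (mapLeaf f) (subst (_ ∈_) (leaves-mapTree f t) l∈)

leaf-mapTree⁺ : (f : A → B) (t : Tree A) {l : Path × A} → l ∈ leaves t → mapLeaf f l ∈ leaves (mapTree f t)
leaf-mapTree⁺ f t l∈ = subst (_ ∈_) (sym (leaves-mapTree f t)) (∈-map⁺ (mapLeaf f) l∈)

edge-mapTree⁻ : (f : A → B) (t : Tree A) {e : Edge B} → e ∈ edges (mapTree f t) →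
  ∃ λ e′ → e′ ∈ edges t × e ≡ mapEdge f e′
edge-mapTree⁻ f t e∈ = ∈-map⁻ (mapEdge f) (subst (_ ∈_) (edges-mapTree f t) e∈)

edge-mapTree⁺ : (f : A → B) (t : Tree A) {e : Edge A} → e ∈ edges t → mapEdge f e ∈ edges (mapTree f t)
edge-mapTree⁺ f t e∈ = subst (_ ∈_) (sym (edges-mapTree f t)) (∈-map⁺ (mapEdge f) e∈)

-- The path of an edge is the path of its child, so it is never empty.
edgesF-nonEmpty : (a : A) (i : ℕ) (ts : List (Tree A)) → All (λ e → edgePath e ≢ []) (edgesF a i ts)
edgesF-nonEmpty a i []       = []
edgesF-nonEmpty a i (t ∷ ts) =
  (λ ()) ∷ All.++⁺ (All.map⁺ (All.tabulate (λ _ ()))) (edgesF-nonEmpty a (suc i) ts)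

edges-nonEmpty : (t : Tree A) → All (λ e → edgePath e ≢ []) (edges t)
edges-nonEmpty (node a ts) = edgesF-nonEmpty a 0 ts

StartsAtLeast : ℕ → Path → Set
StartsAtLeast i []      = ⊥
StartsAtLeast i (j ∷ _) = i ≤ j

edgesF-starts : (a : A) (i : ℕ) (ts : List (Tree A)) → All (StartsAtLeast i ∘ edgePath) (edgesF a i ts)
edgesF-starts a i []       = []
edgesF-starts a i (t ∷ ts) =
  ≤-refl ∷ All.++⁺ (All.map⁺ (All.tabulate (λ _ → ≤-refl)))
                   (All.map (λ {e} → weaken (edgePath e)) (edgesF-starts a (suc i) ts))
  where
  weaken : ∀ p → StartsAtLeast (suc i) p → StartsAtLeast i p
  weaken (j ∷ _) i<j = <⇒≤ i<j

DistinctPaths : Edge A → Edge A → Set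
DistinctPaths e e′ = edgePath e ≢ edgePath e′

mutual
  edges-distinct : (t : Tree A) → AllPairs DistinctPaths (edges t)
  edges-distinct (node a ts) = edgesF-distinct a 0 ts

  edgesF-distinct : (a : A) (i : ℕ) (ts : List (Tree A)) → AllPairs DistinctPaths (edgesF a i ts)
  edgesF-distinct a i []       = []
  edgesF-distinct a i (t ∷ ts) =
      All.++⁺ (All.map⁺ (All.map (λ p≢[] eq → p≢[] (sym (∷-injectiveʳ eq))) (edges-nonEmpty t)))
              (All.map (later []) (edgesF-starts a (suc i) ts))
    ∷ AllPairs.++⁺ (AllPairs.map⁺ (AllPairs.map (λ p≢q eq → p≢q (∷-injectiveʳ eq)) (edges-distinct t)))
                   (edgesF-distinct a (suc i) ts)
                   (All.map⁺ (All.tabulate (λ {e} _ → All.map (later (edgePath e)) (edgesF-starts a (suc i) ts))))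
    where
    later : ∀ p {q} → StartsAtLeast (suc i) q → i ∷ p ≢ q
    later p {j ∷ _} i<j refl = <-irrefl refl i<j

properAncestor-irrefl : ∀ {p q} → ProperAncestor p q → p ≢ q
properAncestor-irrefl {p} (r , r≢[] , q≡p++r) refl = r≢[] (++-identityʳ-unique p q≡p++r)

properAncestor-asym : ∀ {p q} → ProperAncestor p q → ProperAncestor q p → ⊥
properAncestor-asym {p} (r , r≢[] , refl) (s , _ , p≡p++r++s) =
  r≢[] (++-conicalˡ r s (++-identityʳ-unique p (trans p≡p++r++s (++-assoc p r s))))

SwitchAbove : (A → Bool) → List (Edge A) → Path → Set
SwitchAbove P es p = ∃ λ e → e ∈ es × P (parentLabel e) ≡ false × P (childLabel e) ≡ true ×
  ProperAncestor (edgePath e) p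

mutual
  firstSwitch : (P : A → Bool) (t : Tree A) {e : Edge A} → e ∈ edges t →
    P (rootLabel t) ≡ false → P (parentLabel e) ≡ true → SwitchAbove P (edges t) (edgePath e)
  firstSwitch P (node a ts) e∈ root pe = firstSwitchF P a 0 ts e∈ root pe

  firstSwitchF : (P : A → Bool) (a : A) (i : ℕ) (ts : List (Tree A)) {e : Edge A} → e ∈ edgesF a i ts →
    P a ≡ false → P (parentLabel e) ≡ true → SwitchAbove P (edgesF a i ts) (edgePath e)
  firstSwitchF P a i (t ∷ ts) (here refl) root pe with () ← trans (sym root) pe
  firstSwitchF P a i (t ∷ ts) (there e∈) root pe with ∈-++⁻ (map (prependE i) (edges t)) e∈
  ... | inj₂ e∈ts with firstSwitchF P a (suc i) ts e∈ts root pe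
  ...   | e′ , e′∈ , up = e′ , there (∈-++⁺ʳ _ e′∈) , up
  firstSwitchF P a i (t ∷ ts) (there e∈) root pe | inj₁ e∈t with ∈-map⁻ (prependE i) e∈t
  ... | d , d∈ , refl with P (rootLabel t) in Pt
  ...   | true  = (i ∷ [] , a , rootLabel t) , here refl , root , Pt ,
                  (edgePath d , All.lookup (edges-nonEmpty t) d∈ , refl)
  ...   | false with firstSwitch P t d∈ Pt pe
  ...     | e′ , e′∈ , Pe′₁ , Pe′₂ , (r , r≢[] , eq) =
    prependE i e′ , there (∈-++⁺ˡ (∈-map⁺ (prependE i) e′∈)) , Pe′₁ , Pe′₂ , (r , r≢[] , cong (i ∷_) eq)

mutual
  scanTree : (B → A → B) → B → Tree A → Tree (A × B)
  scanTree f b (node a ts) = node (a , f b a) (scanForest f (f b a) ts)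

  scanForest : (B → A → B) → B → List (Tree A) → List (Tree (A × B))
  scanForest f b []       = []
  scanForest f b (t ∷ ts) = scanTree f b t ∷ scanForest f b ts

mutual
  scanTree-erase : (f : B → A → B) (b : B) (t : Tree A) → mapTree proj₁ (scanTree f b t) ≡ t
  scanTree-erase f b (node a ts) = cong (node a) (scanForest-erase f (f b a) ts)

  scanForest-erase : (f : B → A → B) (b : B) (ts : List (Tree A)) → mapForest proj₁ (scanForest f b ts) ≡ ts
  scanForest-erase f b []       = refl
  scanForest-erase f b (t ∷ ts) = cong₂ _∷_ (scanTree-erase f b t) (scanForest-erase f b ts)

scanTree-root : (f : B → A → B) (b : B) (t : Tree A) → rootLabel (scanTree f b t) ≡ (rootLabel t , f b (rootLabel t))
scanTree-root f b (node a ts) = refl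

Scanned : (B → A → B) → A × B → Set
Scanned f (a , b) = ∃ λ b′ → b ≡ f b′ a

ScannedEdge : (B → A → B) → Edge (A × B) → Set
ScannedEdge f e = Scanned f (parentLabel e) × proj₂ (childLabel e) ≡ f (proj₂ (parentLabel e)) (proj₁ (childLabel e))

mutual
  scanTree-edges : (f : B → A → B) (b : B) (t : Tree A) → All (ScannedEdge f) (edges (scanTree f b t))
  scanTree-edges f b (node a ts) = scanForest-edges f b a 0 ts

  scanForest-edges : (f : B → A → B) (b : B) (a : A) (i : ℕ) (ts : List (Tree A)) →
    All (ScannedEdge f) (edgesF (a , f b a) i (scanForest f (f b a) ts))
  scanForest-edges f b a i []               = []
  scanForest-edges f b a i (node a′ us ∷ ts) =
    ((b , refl) , refl) ∷ All.++⁺ (All.map⁺ (scanTree-edges f (f b a) (node a′ us))) (scanForest-edges f b a (suc i) ts)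

mutual
  scanTree-leaves : (f : B → A → B) (b : B) (t : Tree A) → All (Scanned f ∘ proj₂) (leaves (scanTree f b t))
  scanTree-leaves f b (node a [])       = (b , refl) ∷ []
  scanTree-leaves f b (node a (t ∷ ts)) = scanForest-leaves f (f b a) 0 (t ∷ ts)

  scanForest-leaves : (f : B → A → B) (b : B) (i : ℕ) (ts : List (Tree A)) →
    All (Scanned f ∘ proj₂) (leavesF i (scanForest f b ts))
  scanForest-leaves f b i []       = []
  scanForest-leaves f b i (t ∷ ts) = All.++⁺ (All.map⁺ (scanTree-leaves f b t)) (scanForest-leaves f b (suc i) ts)

count-∷ : (q : A → Bool) (x : A) (xs : List A) → length (filterᵇ q xs) ≤ length (filterᵇ q (x ∷ xs))
count-∷ q x xs with q x
... | true  = n≤1+n _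
... | false = ≤-refl

count-map : (q : B → Bool) (f : A → B) (xs : List A) →
  length (filterᵇ q (map f xs)) ≡ length (filterᵇ (q ∘ f) xs)
count-map q f []       = refl
count-map q f (x ∷ xs) with q (f x)
... | true  = cong suc (count-map q f xs)
... | false = count-map q f xs

count-none : (q : A → Bool) (xs : List A) → (∀ {x} → x ∈ xs → q x ≡ true → ⊥) → length (filterᵇ q xs) ≡ 0
count-none q []       none = refl
count-none q (x ∷ xs) none with q x in qx
... | true  = ⊥-elim (none (here refl) qx)
... | false = count-none q xs (none ∘ there)

count-≥1 : (q : A → Bool) {x : A} (xs : List A) → x ∈ xs → q x ≡ true → 1 ≤ length (filterᵇ q xs)
count-≥1 q (y ∷ ys) (here refl) qx rewrite qx = s≤s z≤n
count-≥1 q (y ∷ ys) (there x∈) qx = ≤-trans (count-≥1 q ys x∈ qx) (count-∷ q y ys)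

count-≥2 : (q : A → Bool) {x y : A} (xs : List A) → x ∈ xs → y ∈ xs → x ≢ y → q x ≡ true → q y ≡ true →
  2 ≤ length (filterᵇ q xs)
count-≥2 q (z ∷ zs) (here refl) (here refl) x≢y qx qy = ⊥-elim (x≢y refl)
count-≥2 q (z ∷ zs) (here refl) (there y∈)  x≢y qx qy rewrite qx = s≤s (count-≥1 q zs y∈ qy)
count-≥2 q (z ∷ zs) (there x∈)  (here refl) x≢y qx qy rewrite qy = s≤s (count-≥1 q zs x∈ qx)
count-≥2 q (z ∷ zs) (there x∈)  (there y∈)  x≢y qx qy =
  ≤-trans (count-≥2 q zs x∈ y∈ x≢y qx qy) (count-∷ q z zs)

count-≤1 : (q : A → Bool) (R : A → A → Set) (xs : List A) → AllPairs R xs →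
  (∀ {x y} → x ∈ xs → y ∈ xs → q x ≡ true → q y ≡ true → R x y → ⊥) →
  length (filterᵇ q xs) ≤ 1
count-≤1 q R []       []           clash = z≤n
count-≤1 q R (x ∷ xs) (Rx ∷ Rxs)  clash with q x in qx
... | true  = s≤s (≤-reflexive (count-none q xs (λ y∈ qy → clash (here refl) (there y∈) qx qy (All.lookup Rx y∈))))
... | false = count-≤1 q R xs Rxs (λ x∈ y∈ → clash (there x∈) (there y∈))

count-split : (q q₁ q₂ : A → Bool) (xs : List A) → (∀ x → q x ≡ true → q₁ x ≡ true ⊎ q₂ x ≡ true) →
  length (filterᵇ q xs) ≤ length (filterᵇ q₁ xs) + length (filterᵇ q₂ xs)
count-split q q₁ q₂ []       cover = z≤n
count-split q q₁ q₂ (x ∷ xs) cover with q x in qx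
... | false = ≤-trans (count-split q q₁ q₂ xs cover) (+-mono-≤ (count-∷ q₁ x xs) (count-∷ q₂ x xs))
... | true with q₁ x in q₁x
...   | true  = s≤s (≤-trans (count-split q q₁ q₂ xs cover) (+-monoʳ-≤ (length (filterᵇ q₁ xs)) (count-∷ q₂ x xs)))
...   | false with q₂ x in q₂x | cover x qx
...     | true  | _      = ≤-trans (s≤s (count-split q q₁ q₂ xs cover)) (≤-reflexive (sym (+-suc _ _)))
...     | false | inj₁ q₁x≡true with () ← trans (sym q₁x) q₁x≡true
...     | false | inj₂ ()

switch : ∀ {a b} → a ≡ false → b ≡ true → (a xor b) ≡ true
switch refl refl = refl

switch-down : ∀ {a b} → a ≡ true → b ≡ false → (a xor b) ≡ true
switch-down refl refl = refl

switch-fromFalse : ∀ {a b} → a ≡ false → (a xor b) ≡ true → b ≡ true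
switch-fromFalse refl ab = ab

switch-toFalse : ∀ {a b} → b ≡ false → (a xor b) ≡ true → a ≡ true
switch-toFalse {a} refl ab = trans (sym (xor-identityʳ a)) ab

allFalse : ∀ {k} {v : Vec Bool k} → v ≡ replicate k false → ∀ j → lookup v j ≡ false
allFalse refl j = lookup-replicate j false

#changes-mapTree : ∀ {k} (f : A → Vec Bool k) (t : Tree A) (j : Fin k) →
  #changes (mapTree f t) j ≡ length (filterᵇ (changes j ∘ mapEdge f) (edges t))
#changes-mapTree f t j =
  trans (cong (length ∘ filterᵇ (changes j)) (edges-mapTree f t)) (count-map (changes j) (mapEdge f) (edges t))

GainAboveLoss : ∀ {k} → Fin k → Edge (Vec Bool k) → Edge (Vec Bool k) → Set
GainAboveLoss j e₁ e₂ = ProperAncestor (edgePath e₁) (edgePath e₂)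
  × lookup (parentLabel e₁) j ≡ false × lookup (childLabel e₁) j ≡ true
  × lookup (parentLabel e₂) j ≡ true × lookup (childLabel e₂) j ≡ false

module PPTree {k} (T : Tree (Vec Bool k)) (root : rootLabel T ≡ replicate k false)
              (once : ∀ j → #changes T j ≤ 1) where

  switch-unique : ∀ j {d₁ d₂} → d₁ ∈ edges T → d₂ ∈ edges T → changes j d₁ ≡ true → changes j d₂ ≡ true →
    edgePath d₁ ≡ edgePath d₂
  switch-unique j {d₁} {d₂} d₁∈ d₂∈ c₁ c₂ with ≡-dec ℕ._≟_ (edgePath d₁) (edgePath d₂)
  ... | yes same = same
  ... | no  diff =
    contradiction (count-≥2 (changes j) (edges T) d₁∈ d₂∈ (diff ∘ cong edgePath) c₁ c₂) (≤⇒≯ (once j))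

  switched-above : ∀ j {d d₁} → d ∈ edges T → lookup (parentLabel d) j ≡ true →
    d₁ ∈ edges T → changes j d₁ ≡ true → ProperAncestor (edgePath d₁) (edgePath d)
  switched-above j d∈ pj d₁∈ c₁ with d′ , d′∈ , f , t , above ← firstSwitch (λ l → lookup l j) T d∈ (allFalse root j) pj =
    subst (λ p → ProperAncestor p _) (switch-unique j d′∈ d₁∈ (switch f t) c₁) above

  switch-upward : ∀ j {d} → d ∈ edges T → changes j d ≡ true →
    lookup (parentLabel d) j ≡ false × lookup (childLabel d) j ≡ true
  switch-upward j {d} d∈ c with lookup (parentLabel d) j in pj
  ... | false = refl , c
  ... | true  = ⊥-elim (properAncestor-irrefl
                  (switched-above j d∈ pj d∈ (trans (cong (_xor lookup (childLabel d) j) pj) c)) refl)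

selectPair : ∀ {m} → (Fin m → Bool) → (Fin m → Bool) → Fin m × Fin 2 → Bool
selectPair x x̄ (c , Fin.zero)          = x c
selectPair x x̄ (c , Fin.suc Fin.zero)  = x̄ c

interleave : ∀ {m} → (Fin m → Bool) → (Fin m → Bool) → Vec Bool (m * 2)
interleave {m} x x̄ = tabulate (λ col → selectPair x x̄ (remQuot {m} 2 col))

lookup-interleave-pos : ∀ {m} (x x̄ : Fin m → Bool) c → lookup (interleave x x̄) (posCol c) ≡ x c
lookup-interleave-pos {m} x x̄ c =
  trans (lookup∘tabulate _ (posCol c)) (cong (selectPair x x̄) (remQuot-combine {m} {2} c Fin.zero))

lookup-interleave-neg : ∀ {m} (x x̄ : Fin m → Bool) c → lookup (interleave x x̄) (negCol c) ≡ x̄ c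
lookup-interleave-neg {m} x x̄ c =
  trans (lookup∘tabulate _ (negCol c)) (cong (selectPair x x̄) (remQuot-combine {m} {2} c (Fin.suc Fin.zero)))

tabulate-false : ∀ {n} (f : Fin n → Bool) → (∀ i → f i ≡ false) → tabulate f ≡ replicate n false
tabulate-false {zero}  f f≡false = refl
tabulate-false {suc n} f f≡false = cong₂ Vec._∷_ (f≡false Fin.zero) (tabulate-false (f ∘ Fin.suc) (f≡false ∘ Fin.suc))

interleave-false : ∀ {m} (x x̄ : Fin m → Bool) → (∀ c → x c ≡ false) → (∀ c → x̄ c ≡ false) →
  interleave x x̄ ≡ replicate (m * 2) false
interleave-false {m} x x̄ x≡false x̄≡false = tabulate-false _ (λ col → both (remQuot {m} 2 col))
  where
  both : ∀ p → selectPair x x̄ p ≡ false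
  both (c , Fin.zero)         = x≡false c
  both (c , Fin.suc Fin.zero) = x̄≡false c

column-cases : ∀ {m} (col : Fin (m * 2)) → ∃ λ (c : Fin m) → col ≡ posCol {m} c ⊎ col ≡ negCol {m} c
column-cases {m} col = split (remQuot {m} 2 col) (combine-remQuot {m} 2 col)
  where
  split : ∀ (p : Fin m × Fin 2) → combine (proj₁ p) (proj₂ p) ≡ col → ∃ λ c → col ≡ posCol c ⊎ col ≡ negCol c
  split (c , Fin.zero)         eq = c , inj₁ (sym eq)
  split (c , Fin.suc Fin.zero) eq = c , inj₂ (sym eq)

CompletesPair : Bool → Bool → Bool → Set
CompletesPair true  x x̄ = x ≡ true × x̄ ≡ false
CompletesPair false x x̄ = x ≡ x̄

completed-state : ∀ b x x̄ → CompletesPair b x x̄ → x ∧ not x̄ ≡ b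
completed-state true  x x̄ (refl , refl) = refl
completed-state false x x̄ refl          = ∧-inverseʳ x

module _ {n m} (M : BinMatrix n m) (N : BinMatrix n (m * 2)) where

  extended-pos : ∀ s c {b} → M s c ≡ b → extended M s (posCol c) ≡ extEntry b Fin.zero
  extended-pos s c refl = cong (λ p → extEntry (M s (proj₁ p)) (proj₂ p)) (remQuot-combine {m} {2} c Fin.zero)

  extended-neg : ∀ s c {b} → M s c ≡ b → extended M s (negCol c) ≡ extEntry b (Fin.suc Fin.zero)
  extended-neg s c refl = cong (λ p → extEntry (M s (proj₁ p)) (proj₂ p)) (remQuot-combine {m} {2} c (Fin.suc Fin.zero))

  completion⇒pairs : IsCompletion {n} {m} (extended M) N →
    ∀ s c → CompletesPair (M s c) (N s (posCol c)) (N s (negCol c))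
  completion⇒pairs (zeros , ones , unknowns) s c with M s c in Msc
  ... | true  = ones s (posCol c) (extended-pos s c Msc) , zeros s (negCol c) (extended-neg s c Msc)
  ... | false = unknowns s c (extended-pos s c Msc) (extended-neg s c Msc)

  pairs⇒completion : (∀ s c → CompletesPair (M s c) (N s (posCol c)) (N s (negCol c))) →
    IsCompletion {n} {m} (extended M) N
  pairs⇒completion pairs = zeros , ones , unknowns
    where
    zeros : ∀ s col → extended M s col ≡ e0 → N s col ≡ false
    zeros s col e with column-cases {m} col
    ... | c , inj₁ refl = posZero (M s c) (trans (sym (extended-pos s c refl)) e)
      where posZero : ∀ b → extEntry b Fin.zero ≡ e0 → N s (posCol c) ≡ false
            posZero true ()
            posZero false ()
    ... | c , inj₂ refl = negZero (M s c) (pairs s c) (trans (sym (extended-neg s c refl)) e)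
      where negZero : ∀ b → CompletesPair b (N s (posCol c)) (N s (negCol c)) →
                        extEntry b (Fin.suc Fin.zero) ≡ e0 → N s (negCol c) ≡ false
            negZero true  (_ , x̄≡false) _ = x̄≡false
            negZero false _ ()

    ones : ∀ s col → extended M s col ≡ e1 → N s col ≡ true
    ones s col e with column-cases {m} col
    ... | c , inj₁ refl = posOne (M s c) (pairs s c) (trans (sym (extended-pos s c refl)) e)
      where posOne : ∀ b → CompletesPair b (N s (posCol c)) (N s (negCol c)) →
                       extEntry b Fin.zero ≡ e1 → N s (posCol c) ≡ true
            posOne true  (x≡true , _) _ = x≡true
            posOne false _ ()
    ... | c , inj₂ refl = negOne (M s c) (trans (sym (extended-neg s c refl)) e)
      where negOne : ∀ b → extEntry b (Fin.suc Fin.zero) ≡ e1 → N s (negCol c) ≡ true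
            negOne true ()
            negOne false ()

    unknowns : ∀ s c → extended M s (posCol c) ≡ e? → extended M s (negCol c) ≡ e? →
      N s (posCol c) ≡ N s (negCol c)
    unknowns s c e _ = posUnknown (M s c) (pairs s c) (trans (sym (extended-pos s c refl)) e)
      where posUnknown : ∀ b → CompletesPair b (N s (posCol c)) (N s (negCol c)) →
                           extEntry b Fin.zero ≡ e? → N s (posCol c) ≡ N s (negCol c)
            posUnknown true  _ ()
            posUnknown false x≡x̄ _ = x≡x̄

-- (⇐) From a pp tree of a completion to a p-pp tree

and-not-switch : ∀ a b c d → ((a ∧ not b) xor (c ∧ not d)) ≡ true → (a xor c) ≡ true ⊎ (b xor d) ≡ true
and-not-switch false b false d ()
and-not-switch false b true  d _ = inj₁ refl
and-not-switch true  b false d _ = inj₁ refl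
and-not-switch true  b true  d h = inj₂ (trans (sym (xor-annihilates-not b d)) h)

rowsLabelLeaves-map : ∀ {n k k′} {N : BinMatrix n k} {M : BinMatrix n k′}
  (f : Vec Bool k → Vec Bool k′) (T : Tree (Vec Bool k)) →
  (∀ s l → (∀ j → lookup l j ≡ N s j) → ∀ c → lookup (f l) c ≡ M s c) →
  RowsLabelLeaves N T → RowsLabelLeaves M (mapTree f T)
rowsLabelLeaves-map f T f-row (σ , σ∈ , σ-label , σ-inj) =
  mapLeaf f ∘ σ , (λ s → leaf-mapTree⁺ f T (σ∈ s)) , (λ s → f-row s (proj₂ (σ s)) (σ-label s)) , σ-inj

module CompletionToPersistent {n m} (M : BinMatrix n m) (N : BinMatrix n (m * 2))
  (pairs : ∀ s c → CompletesPair (M s c) (N s (posCol c)) (N s (negCol c)))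
  (T : Tree (Vec Bool (m * 2))) (root : rootLabel T ≡ replicate (m * 2) false)
  (once : ∀ j → #changes T j ≤ 1) (rows : RowsLabelLeaves N T) where

  open PPTree T root once

  present : Vec Bool (m * 2) → Fin m → Bool
  present l c = lookup l (posCol c) ∧ not (lookup l (negCol c))

  collapse : Vec Bool (m * 2) → Vec Bool m
  collapse l = tabulate (present l)

  T′ : Tree (Vec Bool m)
  T′ = mapTree collapse T

  root′ : rootLabel T′ ≡ replicate m false
  root′ = trans (rootLabel-mapTree collapse T)
    (tabulate-false _ (λ c → cong₂ (λ x x̄ → x ∧ not x̄) (allFalse root (posCol c)) (allFalse root (negCol c))))

  changes-collapse : ∀ d c → changes c (mapEdge collapse d) ≡ present (parentLabel d) c xor present (childLabel d) c
  changes-collapse d c = cong₂ _xor_ (lookup∘tabulate _ c) (lookup∘tabulate _ c)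

  change-source : ∀ c d → changes c (mapEdge collapse d) ≡ true →
    changes (posCol c) d ≡ true ⊎ changes (negCol c) d ≡ true
  change-source c d ch =
    and-not-switch (lookup (parentLabel d) (posCol c)) (lookup (parentLabel d) (negCol c))
                   (lookup (childLabel d) (posCol c)) (lookup (childLabel d) (negCol c)) (trans (sym (changes-collapse d c)) ch)

  -- each state changes at most twice: once per column of its pair
  twice : ∀ c → #changes T′ c ≤ 2
  twice c = begin
    #changes T′ c                                                 ≡⟨ #changes-mapTree collapse T c ⟩
    length (filterᵇ (changes c ∘ mapEdge collapse) (edges T))     ≤⟨ count-split _ _ _ (edges T) (change-source c) ⟩
    #changes T (posCol c) + #changes T (negCol c)                 ≤⟨ +-mono-≤ (once (posCol c)) (once (negCol c)) ⟩
    2                                                             ∎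
    where open ℕ.≤-Reasoning

  gain-above-loss : ∀ c {d₁ d₂} → d₁ ∈ edges T → d₂ ∈ edges T →
    changes (posCol c) d₁ ≡ true → changes (negCol c) d₂ ≡ true →
    changes c (mapEdge collapse d₁) ≡ true → changes c (mapEdge collapse d₂) ≡ true →
    GainAboveLoss c (mapEdge collapse d₁) (mapEdge collapse d₂)
  gain-above-loss c {d₁} {d₂} d₁∈ d₂∈ pos₁ neg₂ ch₁ ch₂ =
    switched-above (posCol c) d₂∈ (∧-conicalˡ _ _ start₂) d₁∈ pos₁ ,
    trans (lookup∘tabulate _ c) start₁ , trans (lookup∘tabulate _ c) end₁ ,
    trans (lookup∘tabulate _ c) start₂ , trans (lookup∘tabulate _ c) end₂
    where
    start₁ : present (parentLabel d₁) c ≡ false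
    start₁ = cong (_∧ not (lookup (parentLabel d₁) (negCol c))) (proj₁ (switch-upward (posCol c) d₁∈ pos₁))
    end₁ : present (childLabel d₁) c ≡ true
    end₁ = switch-fromFalse start₁ (trans (sym (changes-collapse d₁ c)) ch₁)
    end₂ : present (childLabel d₂) c ≡ false
    end₂ = trans (cong (λ b → lookup (childLabel d₂) (posCol c) ∧ not b) (proj₂ (switch-upward (negCol c) d₂∈ neg₂)))
                 (∧-zeroʳ (lookup (childLabel d₂) (posCol c)))
    start₂ : present (parentLabel d₂) c ≡ true
    start₂ = switch-toFalse end₂ (trans (sym (changes-collapse d₂ c)) ch₂)

  -- two changes of c in T′ come from the edge of c and the edge of c̄
  persistent : ∀ c (E₁ E₂ : Edge (Vec Bool m)) → E₁ ∈ edges T′ → E₂ ∈ edges T′ →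
    changes c E₁ ≡ true → changes c E₂ ≡ true → edgePath E₁ ≢ edgePath E₂ → TwoChangesOK c E₁ E₂
  persistent c E₁ E₂ E₁∈ E₂∈ ch₁ ch₂ diff with edge-mapTree⁻ collapse T E₁∈ | edge-mapTree⁻ collapse T E₂∈
  ... | d₁ , d₁∈ , refl | d₂ , d₂∈ , refl with change-source c d₁ ch₁ | change-source c d₂ ch₂
  ...   | inj₁ pos₁ | inj₁ pos₂ = ⊥-elim (diff (switch-unique (posCol c) d₁∈ d₂∈ pos₁ pos₂))
  ...   | inj₂ neg₁ | inj₂ neg₂ = ⊥-elim (diff (switch-unique (negCol c) d₁∈ d₂∈ neg₁ neg₂))
  ...   | inj₁ pos₁ | inj₂ neg₂ = inj₁ (gain-above-loss c d₁∈ d₂∈ pos₁ neg₂ ch₁ ch₂)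
  ...   | inj₂ neg₁ | inj₁ pos₂ = inj₂ (gain-above-loss c d₂∈ d₁∈ pos₂ neg₁ ch₂ ch₁)

  rows′ : RowsLabelLeaves M T′
  rows′ = rowsLabelLeaves-map collapse T leaf-state rows
    where
    leaf-state : ∀ s l → (∀ j → lookup l j ≡ N s j) → ∀ c → lookup (collapse l) c ≡ M s c
    leaf-state s l l≡N c = begin
      lookup (collapse l) c                   ≡⟨ lookup∘tabulate _ c ⟩
      present l c                             ≡⟨ cong₂ (λ x x̄ → x ∧ not x̄) (l≡N (posCol c)) (l≡N (negCol c)) ⟩
      N s (posCol c) ∧ not (N s (negCol c))   ≡⟨ completed-state (M s c) _ _ (pairs s c) ⟩
      M s c                                   ∎
      where open ≡-Reasoning

  result : HasPPPTree M
  result = T′ , root′ , twice , persistent , rows′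

-- (⇒) From a p-pp tree to a pp tree of a completion

-- Bits of c along an annotated edge: state o₁ and gained flag g₁ = z ∨ o₁
-- at the parent, state o₂ and g₂ = g₁ ∨ o₂ at the child.

gain-switch : ∀ {z o₁ o₂ g₁ g₂} → g₁ ≡ z ∨ o₁ → g₂ ≡ g₁ ∨ o₂ → (g₁ xor g₂) ≡ true → o₁ ≡ false × o₂ ≡ true
gain-switch {true}                refl refl ()
gain-switch {false} {true}        refl refl ()
gain-switch {false} {false} {true}  refl refl _ = refl , refl
gain-switch {false} {false} {false} refl refl ()

loss-switch : ∀ {z o₁ o₂ g₁ g₂} → g₁ ≡ z ∨ o₁ → g₂ ≡ g₁ ∨ o₂ →
  ((g₁ ∧ not o₁) xor (g₂ ∧ not o₂)) ≡ true → g₁ ≡ true × (o₁ xor o₂) ≡ true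
loss-switch {true}  {true}  {true}  refl refl ()
loss-switch {true}  {true}  {false} refl refl _ = refl , refl
loss-switch {true}  {false} {true}  refl refl _ = refl , refl
loss-switch {true}  {false} {false} refl refl ()
loss-switch {false} {true}  {true}  refl refl ()
loss-switch {false} {true}  {false} refl refl _ = refl , refl
loss-switch {false} {false} {true}  refl refl ()
loss-switch {false} {false} {false} refl refl ()

loss-onset : ∀ {z o₁ o₂ g₁ g₂} → g₁ ≡ z ∨ o₁ → g₂ ≡ g₁ ∨ o₂ →
  (g₁ ∧ not o₁) ≡ false → (g₂ ∧ not o₂) ≡ true → o₁ ≡ true × o₂ ≡ false
loss-onset {true}  {true}  {true}  refl refl _  ()
loss-onset {true}  {true}  {false} refl refl _  _ = refl , refl
loss-onset {true}  {false}         refl refl () _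
loss-onset {false} {true}  {true}  refl refl _  ()
loss-onset {false} {true}  {false} refl refl _  _ = refl , refl
loss-onset {false} {false} {true}  refl refl _  ()
loss-onset {false} {false} {false} refl refl _  ()

gained-completes : ∀ {o g b} z → o ≡ b → g ≡ z ∨ o → CompletesPair b g (g ∧ not o)
gained-completes {true}  z refl refl = ∨-zeroʳ z , ∧-zeroʳ (z ∨ true)
gained-completes {false} z refl refl = sym (∧-identityʳ (z ∨ false))

PersistentChanges : ∀ {m} → Tree (Vec Bool m) → Set
PersistentChanges {m} T = ∀ (j : Fin m) (e₁ e₂ : Edge (Vec Bool m)) → e₁ ∈ edges T → e₂ ∈ edges T →
  changes j e₁ ≡ true → changes j e₂ ≡ true → edgePath e₁ ≢ edgePath e₂ → TwoChangesOK j e₁ e₂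

module PersistentToCompletion {n m} (M : BinMatrix n m) (T : Tree (Vec Bool m))
  (root : rootLabel T ≡ replicate m false) (persistent : PersistentChanges T)
  (rows : RowsLabelLeaves M T) where

  -- a node labelled (o , g): its state o and the characters g gained so far
  Label : Set
  Label = Vec Bool m × Vec Bool m

  state gained lost : Label → Fin m → Bool
  state  l c = lookup (proj₁ l) c
  gained l c = lookup (proj₂ l) c
  lost   l c = gained l c ∧ not (state l c)

  annotated : Tree Label
  annotated = scanTree (zipWith _∨_) (replicate m false) T

  scanned-bit : ∀ {l : Label} → Scanned (zipWith _∨_) l → ∀ c → ∃ λ z → gained l c ≡ z ∨ state l c
  scanned-bit {o , g} (z , refl) c = lookup z c , lookup-zipWith _∨_ c z o

  edge-bits : ∀ {e} → e ∈ edges annotated → ∀ c →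
    (∃ λ z → gained (parentLabel e) c ≡ z ∨ state (parentLabel e) c) ×
    gained (childLabel e) c ≡ gained (parentLabel e) c ∨ state (childLabel e) c
  edge-bits {e} e∈ c with parentScanned , childStep ← All.lookup (scanTree-edges _ _ T) e∈ =
    scanned-bit parentScanned c ,
    trans (cong (λ v → lookup v c) childStep) (lookup-zipWith _∨_ c (proj₂ (parentLabel e)) (proj₁ (childLabel e)))

  T-edge : ∀ {e} → e ∈ edges annotated → mapEdge proj₁ e ∈ edges T
  T-edge {e} e∈ = subst (λ t → mapEdge proj₁ e ∈ edges t) (scanTree-erase _ _ T) (edge-mapTree⁺ proj₁ annotated e∈)

  gained-root : ∀ c → gained (rootLabel annotated) c ≡ false
  gained-root c = begin
    gained (rootLabel annotated) c                          ≡⟨ cong (λ l → gained l c) (scanTree-root _ _ T) ⟩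
    lookup (zipWith _∨_ (replicate m false) (rootLabel T)) c ≡⟨ lookup-zipWith _∨_ c (replicate m false) (rootLabel T) ⟩
    lookup (replicate m false) c ∨ lookup (rootLabel T) c    ≡⟨ cong₂ _∨_ (lookup-replicate c false) (allFalse root c) ⟩
    false                                                    ∎
    where open ≡-Reasoning

  lost-root : ∀ c → lost (rootLabel annotated) c ≡ false
  lost-root c = cong (_∧ not (state (rootLabel annotated) c)) (gained-root c)

  -- Persistence: c is never switched on below a node where it has been lost,
  -- since the edge losing c would lie above an edge gaining it.
  no-regain : ∀ c {e} → e ∈ edges annotated →
    gained (parentLabel e) c ≡ true → state (parentLabel e) c ≡ false → state (childLabel e) c ≡ true → ⊥
  no-regain c {e} e∈ g₁ o₁ o₂
    with e′ , e′∈ , l₁ , l₂ , above ← firstSwitch (λ l → lost l c) annotated e∈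
           (lost-root c) (cong₂ (λ g o → g ∧ not o) g₁ o₁)
    with (z , g′₁) , g′₂ ← edge-bits e′∈ c
    with o′₁ , o′₂ ← loss-onset g′₁ g′₂ l₁ l₂
    with persistent c (mapEdge proj₁ e′) (mapEdge proj₁ e) (T-edge e′∈) (T-edge e∈)
           (switch-down o′₁ o′₂) (switch o₁ o₂) (properAncestor-irrefl above)
  ... | inj₁ (_ , o′₁≡false , _) with () ← trans (sym o′₁) o′₁≡false
  ... | inj₂ (above′ , _) = properAncestor-asym above above′

  relabel : Label → Vec Bool (m * 2)
  relabel l = interleave (gained l) (lost l)

  T″ : Tree (Vec Bool (m * 2))
  T″ = mapTree relabel annotated

  gain-edge : ∀ c {e} → e ∈ edges annotated → changes (posCol c) (mapEdge relabel e) ≡ true →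
    state (parentLabel e) c ≡ false × state (childLabel e) c ≡ true
  gain-edge c {e} e∈ ch with (z , g₁) , g₂ ← edge-bits e∈ c =
    gain-switch g₁ g₂ (trans (sym (cong₂ _xor_ (lookup-interleave-pos _ _ c) (lookup-interleave-pos _ _ c))) ch)

  loss-edge : ∀ c {e} → e ∈ edges annotated → changes (negCol c) (mapEdge relabel e) ≡ true →
    gained (parentLabel e) c ≡ true × changes c (mapEdge proj₁ e) ≡ true
  loss-edge c {e} e∈ ch with (z , g₁) , g₂ ← edge-bits e∈ c =
    loss-switch g₁ g₂ (trans (sym (cong₂ _xor_ (lookup-interleave-neg _ _ c) (lookup-interleave-neg _ _ c))) ch)

  at-most-once : ∀ col → (∀ {x y} → x ∈ edges annotated → y ∈ edges annotated →
      changes col (mapEdge relabel x) ≡ true → changes col (mapEdge relabel y) ≡ true → DistinctPaths x y → ⊥) →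
    #changes T″ col ≤ 1
  at-most-once col clash = begin
    #changes T″ col                                                  ≡⟨ #changes-mapTree relabel annotated col ⟩
    length (filterᵇ (changes col ∘ mapEdge relabel) (edges annotated)) ≤⟨ count-≤1 _ DistinctPaths _ (edges-distinct annotated) clash ⟩
    1                                                                ∎
    where open ℕ.≤-Reasoning

  -- two gains of c would be two 0→1 switches of c in T
  once-pos : ∀ c → #changes T″ (posCol c) ≤ 1
  once-pos c = at-most-once (posCol c) clash
    where
    clash : ∀ {x y} → x ∈ edges annotated → y ∈ edges annotated → changes (posCol c) (mapEdge relabel x) ≡ true →
      changes (posCol c) (mapEdge relabel y) ≡ true → DistinctPaths x y → ⊥
    clash x∈ y∈ chx chy diff with fx , tx ← gain-edge c x∈ chx | fy , ty ← gain-edge c y∈ chy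
      with persistent c _ _ (T-edge x∈) (T-edge y∈) (switch fx tx) (switch fy ty) diff
    ... | inj₁ (_ , _ , _ , _ , fy′) with () ← trans (sym ty) fy′
    ... | inj₂ (_ , _ , _ , _ , fx′) with () ← trans (sym tx) fx′

  -- of two losses of c, the upper one would be a regain
  once-neg : ∀ c → #changes T″ (negCol c) ≤ 1
  once-neg c = at-most-once (negCol c) clash
    where
    clash : ∀ {x y} → x ∈ edges annotated → y ∈ edges annotated → changes (negCol c) (mapEdge relabel x) ≡ true →
      changes (negCol c) (mapEdge relabel y) ≡ true → DistinctPaths x y → ⊥
    clash x∈ y∈ chx chy diff with gx , cx ← loss-edge c x∈ chx | gy , cy ← loss-edge c y∈ chy
      with persistent c _ _ (T-edge x∈) (T-edge y∈) cx cy diff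
    ... | inj₁ (_ , fx , tx , _) = no-regain c x∈ gx fx tx
    ... | inj₂ (_ , fy , ty , _) = no-regain c y∈ gy fy ty

  once″ : ∀ col → #changes T″ col ≤ 1
  once″ col with column-cases {m} col
  ... | c , inj₁ refl = once-pos c
  ... | c , inj₂ refl = once-neg c

  root″ : rootLabel T″ ≡ replicate (m * 2) false
  root″ = trans (rootLabel-mapTree relabel annotated)
    (interleave-false _ _ gained-root lost-root)

  leafOf : ∀ s → ∃ λ x → x ∈ leaves annotated × proj₁ rows s ≡ mapLeaf proj₁ x
  leafOf s = leaf-mapTree⁻ proj₁ annotated
    (subst (λ t → proj₁ rows s ∈ leaves t) (sym (scanTree-erase _ _ T)) (proj₁ (proj₂ rows) s))

  leafLabel : Fin n → Label
  leafLabel s = proj₂ (proj₁ (leafOf s))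

  N′ : BinMatrix n (m * 2)
  N′ s = lookup (relabel (leafLabel s))

  leaf-state : ∀ s c → state (leafLabel s) c ≡ M s c
  leaf-state s c =
    trans (cong (λ l → lookup (proj₂ l) c) (sym (proj₂ (proj₂ (leafOf s))))) (proj₁ (proj₂ (proj₂ rows)) s c)

  N′-pairs : ∀ s c → CompletesPair (M s c) (N′ s (posCol c)) (N′ s (negCol c))
  N′-pairs s c with z , g≡ ← scanned-bit (All.lookup (scanTree-leaves _ _ T) (proj₁ (proj₂ (leafOf s)))) c =
    subst₂ (CompletesPair (M s c)) (sym (lookup-interleave-pos _ _ c)) (sym (lookup-interleave-neg _ _ c))
      (gained-completes z (leaf-state s c) g≡)

  rows″ : RowsLabelLeaves N′ T″
  rows″ = (λ s → mapLeaf relabel (proj₁ (leafOf s))) ,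
          (λ s → leaf-mapTree⁺ relabel annotated (proj₁ (proj₂ (leafOf s)))) ,
          (λ s col → refl) ,
          (λ s s′ same → proj₂ (proj₂ (proj₂ rows)) s s′
             (trans (cong proj₁ (proj₂ (proj₂ (leafOf s)))) (trans same (cong proj₁ (sym (proj₂ (proj₂ (leafOf s′))))))))

  result : Σ (BinMatrix n (m * 2)) (λ N → IsCompletion {n} {m} (extended M) N × HasPPTree N)
  result = N′ , pairs⇒completion M N′ N′-pairs , T″ , root″ , once″ , rows″

theorem1 : ∀ {n m : ℕ} (M : BinMatrix n m) → NoZeroColumn M →
    HasPPPTree M ⇔ Σ (BinMatrix n (m * 2)) (λ N → IsCompletion {n} {m} (extended M) N × HasPPTree N)
theorem1 M _ = mk⇔
  (λ (T , root , _ , persistent , rows) → PersistentToCompletion.result M T root persistent rows)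
  (λ (N , completion , T , root , once , rows) →
     CompletionToPersistent.result M N (completion⇒pairs M N completion) T root once rows)
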